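{- Let $d\ge 1$ and $\pi\in NC(d)$. Then $k\in[1,d-1]$ is an antisingleton element of $\pi$ if and only if $d-k$ is a singleton element of $\alpha(\pi)$.
   Context: $NC(d)$ is the set of noncrossing partitions of $[1,d]$. An element is a singleton of a partition if it forms a block by itself; $k\in[1,d]$ is an antisingleton of $\pi$ if $k$ and $k+1$ lie in the same block of $\pi$ (with $d+1$ read as $1$). The Simion–Ullman involution $\alpha:NC(d)\to NC(d)$: place points $1,\dots,d$ clockwise on a circle; for $1\le i\le d-1$ place a new point labelled $(d-i)'$ on the arc between $i$ and $i+1$, and a point $d'$ on the arc between $d$ and $1$ (so $1',\dots,d'$ appear counterclockwise). Represent each block of $\pi$ by the convex hull of its points. Then $\alpha(\pi)$ is the coarsest noncrossing partition of $\{1',\dots,d'\}$ whose block convex hulls do not intersect those of $\pi$; identifying $i'$ with $i$ gives $\alpha(\pi)\in NC(d)$. -}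

module Defs where

open import Data.Nat using (ℕ; zero; suc; _+_; _*_; _∸_; _≤_; _<_)
open import Data.Product using (_×_)
open import Data.Sum using (_⊎_)
open import Data.Empty using (⊥)
open import Relation.Nullary using (¬_)
open import Relation.Binary.PropositionalEquality using (_≡_)

-- A set partition of [1,d] is given by a block-labelling function
-- p : ℕ → ℕ ; elements i, j ∈ [1,d] lie in the same block iff p i ≡ p j.
-- (Values of p outside [1,d] are irrelevant.)
Partition : Set
Partition = ℕ → ℕ

InRange : ℕ → ℕ → Set
InRange d i = 1 ≤ i × i ≤ d

NonCrossing : ℕ → Partition → Set
NonCrossing d p =
  ∀ a b c e → 1 ≤ a → a < b → b < c → c < e → e ≤ d →
  p a ≡ p c → p b ≡ p e → p a ≡ p b

IsNC : ℕ → Partition → Set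
IsNC = NonCrossing

-- Positions on the circle (2d points, numbered 1..2d clockwise).
-- The original point i ∈ [1,d] sits at position 2i-1.
pos : ℕ → ℕ
pos i = 2 * i ∸ 1

-- The primed point j' (1 ≤ j ≤ d): for j ≤ d-1, j' = (d-i)' with i = d-j
-- lies on the arc between i and i+1, i.e. at position 2i = 2(d-j);
-- d' lies on the arc between d and 1, at position 2d.
pos′ : ℕ → ℕ → ℕ
pos′ d j with d ∸ j
... | zero  = 2 * d
... | suc m = 2 * suc m

Interleave : ℕ → ℕ → ℕ → ℕ → Set
Interleave x z y w = (x < y × y < z × z < w) ⊎ (y < x × x < w × w < z)

-- The convex hulls of a block of π (unprimed points) and a block of σ
-- (primed points) intersect iff some two points of the first and two points
-- of the second alternate around the circle.
Compatible : ℕ → Partition → Partition → Set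
Compatible d π σ =
  ∀ a c b e → InRange d a → InRange d c → InRange d b → InRange d e →
  π a ≡ π c → σ b ≡ σ e →
  ¬ Interleave (pos a) (pos c) (pos′ d b) (pos′ d e)

Refines : ℕ → Partition → Partition → Set
Refines d τ σ = ∀ i j → InRange d i → InRange d j → τ i ≡ τ j → σ i ≡ σ j

-- σ is α(π) (after identifying i' with i): the coarsest noncrossing
-- partition of the primed points whose block hulls avoid those of π.
IsAlpha : ℕ → Partition → Partition → Set
IsAlpha d π σ =
  IsNC d σ × Compatible d π σ ×
  (∀ τ → IsNC d τ → Compatible d π τ → Refines d τ σ)

Singleton : ℕ → Partition → ℕ → Set
Singleton d p s = InRange d s × (∀ j → InRange d j → p j ≡ p s → j ≡ s)

Antisingleton : ℕ → Partition → ℕ → Set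
Antisingleton d p k with d ∸ k
... | zero  = InRange d k × p k ≡ p 1
... | suc _ = InRange d k × p k ≡ p (suc k)

-- Label the gap between i and i+1 (and between d and 1) by g = i; the primed point (d-g)'
-- (read as d' when g = d) sits in gap g, at circle position 2g.  If k and k+1 share a
-- block of π, the chord between them cuts gap k off from every other gap, so (d-k)' is a
-- singleton of α(π).  Conversely, if k and k+1 lie in different blocks, noncrossing of π
-- yields another gap g such that the points strictly between gaps g and k form a union of
-- blocks of π; joining the primed points of these two gaps is then compatible with π, so
-- by maximality α(π) joins them and (d-k)' is not a singleton.
module Submission where

open import Defs
open import Data.Nat using (ℕ; zero; suc; _+_; _*_; _∸_; _≤_; _<_; z≤n; s≤s; _≟_; _≤?_)
open import Data.Nat.Properties
open import Data.Product using (_×_; _,_; ∃-syntax; proj₁; proj₂)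
open import Data.Sum using (_⊎_; inj₁; inj₂; [_,_]′)
open import Data.Empty using (⊥; ⊥-elim)
open import Function.Base using (_∘_)
open import Function.Bundles using (_⇔_; mk⇔; Equivalence)
open import Relation.Nullary using (¬_; yes; no; Dec)
open import Relation.Nullary.Decidable using (decidable-stable)
open import Relation.Binary.PropositionalEquality
  using (_≡_; _≢_; refl; sym; trans; cong; subst; subst₂; module ≡-Reasoning)
open import Relation.Binary.Definitions using (tri<; tri≈; tri>)

pos-suc : ∀ a → pos (suc a) ≡ suc (2 * a)
pos-suc a = +-suc a (a + 0)

pos<even⇔ : ∀ {a} g → 1 ≤ a → pos a < 2 * g ⇔ a ≤ g
pos<even⇔ {suc a} g _ rewrite pos-suc a = mk⇔
  (λ h → *-cancelˡ-< 2 a g (<-trans (n<1+n _) h))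
  (λ h → ≤-trans (≤-reflexive (sym (*-suc 2 a))) (*-monoʳ-≤ 2 h))

even<pos⇔ : ∀ {a} g → 1 ≤ a → 2 * g < pos a ⇔ g < a
even<pos⇔ {suc a} g _ rewrite pos-suc a = mk⇔
  (λ h → s≤s (*-cancelˡ-≤ 2 (≤-pred h)))
  (λ h → s≤s (*-monoʳ-≤ 2 (≤-pred h)))

interleave⇒< : ∀ {x z y w} → Interleave x z y w → y < w
interleave⇒< (inj₁ (_ , y<z , z<w)) = <-trans y<z z<w
interleave⇒< (inj₂ (y<x , x<w , _)) = <-trans y<x x<w

interleave-gaps⇔ : ∀ {a c g h} → 1 ≤ a → 1 ≤ c →
  Interleave (pos a) (pos c) (2 * g) (2 * h) ⇔
  ((a ≤ g × g < c × c ≤ h) ⊎ (g < a × a ≤ h × h < c))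
interleave-gaps⇔ {a} {c} {g} {h} 1≤a 1≤c = mk⇔ toIntervals fromIntervals
  where
  open Equivalence
  toIntervals : Interleave (pos a) (pos c) (2 * g) (2 * h) →
       (a ≤ g × g < c × c ≤ h) ⊎ (g < a × a ≤ h × h < c)
  toIntervals (inj₁ (p , q , r)) =
    inj₁ (to (pos<even⇔ g 1≤a) p , to (even<pos⇔ g 1≤c) q , to (pos<even⇔ h 1≤c) r)
  toIntervals (inj₂ (p , q , r)) =
    inj₂ (to (even<pos⇔ g 1≤a) p , to (pos<even⇔ h 1≤a) q , to (even<pos⇔ h 1≤c) r)
  fromIntervals : (a ≤ g × g < c × c ≤ h) ⊎ (g < a × a ≤ h × h < c) →
         Interleave (pos a) (pos c) (2 * g) (2 * h)
  fromIntervals (inj₁ (p , q , r)) =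
    inj₁ (from (pos<even⇔ g 1≤a) p , from (even<pos⇔ g 1≤c) q , from (pos<even⇔ h 1≤c) r)
  fromIntervals (inj₂ (p , q , r)) =
    inj₂ (from (even<pos⇔ g 1≤a) p , from (pos<even⇔ h 1≤a) q , from (even<pos⇔ h 1≤c) r)

pos′-below : ∀ d j → 1 ≤ d ∸ j → pos′ d j ≡ 2 * (d ∸ j)
pos′-below d j h with d ∸ j | h
... | suc _ | _ = refl

pos′-top : ∀ d → pos′ d d ≡ 2 * d
pos′-top d with d ∸ d | n∸n≡0 d
... | .zero | refl = refl

pos′-d∸ : ∀ {d g} → 1 ≤ g → g ≤ d → pos′ d (d ∸ g) ≡ 2 * g
pos′-d∸ {d} {g} 1≤g g≤d = begin
  pos′ d (d ∸ g)         ≡⟨ pos′-below d (d ∸ g) (subst (1 ≤_) (sym d∸[d∸g]≡g) 1≤g) ⟩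
  2 * (d ∸ (d ∸ g))      ≡⟨ cong (2 *_) d∸[d∸g]≡g ⟩
  2 * g                  ∎
  where
  open ≡-Reasoning
  d∸[d∸g]≡g : d ∸ (d ∸ g) ≡ g
  d∸[d∸g]≡g = m∸[m∸n]≡n g≤d

gap-point : ∀ {d g} → 1 ≤ g → g ≤ d → ∃[ j ] InRange d j × pos′ d j ≡ 2 * g
gap-point {d} {g} 1≤g g≤d with m≤n⇒m<n∨m≡n g≤d
... | inj₁ g<d  = d ∸ g , (m<n⇒0<n∸m g<d , m∸n≤m d g) , pos′-d∸ 1≤g g≤d
... | inj₂ refl = g , (1≤g , ≤-refl) , pos′-top g

pos′-even : ∀ {d j} → InRange d j → ∃[ g ] 1 ≤ g × g ≤ d × pos′ d j ≡ 2 * g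
pos′-even {d} {j} (1≤j , j≤d) with m≤n⇒m<n∨m≡n j≤d
... | inj₁ j<d  = d ∸ j , m<n⇒0<n∸m j<d , m∸n≤m d j , pos′-below d j (m<n⇒0<n∸m j<d)
... | inj₂ refl = j , 1≤j , ≤-refl , pos′-top j

pos′-d∸-unique : ∀ {d j k} → InRange d j → k < d → pos′ d j ≡ 2 * k → j ≡ d ∸ k
pos′-d∸-unique {d} {j} {k} (_ , j≤d) k<d pj with m≤n⇒m<n∨m≡n j≤d
... | inj₁ j<d  = trans (sym (m∸[m∸n]≡n j≤d)) (cong (d ∸_) d∸j≡k)
  where
  d∸j≡k : d ∸ j ≡ k
  d∸j≡k = *-cancelˡ-≡ (d ∸ j) k 2 (trans (sym (pos′-below d j (m<n⇒0<n∸m j<d))) pj)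
... | inj₂ refl = ⊥-elim (<⇒≢ k<d (sym (*-cancelˡ-≡ j k 2 (trans (sym (pos′-top j)) pj))))

merge : ℕ → ℕ → Partition
merge i j x with x ≟ j
... | yes _ = i
... | no _  = x

merge-related : ∀ {i j b e} → merge i j b ≡ merge i j e →
  b ≡ e ⊎ (b ≡ i × e ≡ j) ⊎ (b ≡ j × e ≡ i)
merge-related {i} {j} {b} {e} h with b ≟ j | e ≟ j
... | yes refl | yes refl = inj₁ refl
... | yes b≡j  | no _     = inj₂ (inj₂ (b≡j , sym h))
... | no _     | yes e≡j  = inj₂ (inj₁ (h , e≡j))
... | no _     | no _     = inj₁ h

merge-identifies : ∀ i j → merge i j i ≡ merge i j j
merge-identifies i j with i ≟ j | j ≟ j
... | _     | no j≢j = ⊥-elim (j≢j refl)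
... | yes _ | yes _  = refl
... | no _  | yes _  = refl

merge-noncrossing : ∀ d i j → NonCrossing d (merge i j)
merge-noncrossing d i j a b c e _ a<b b<c c<e _ ac be =
  ⊥-elim (crossing (merge-related {i} {j} ac) (merge-related {i} {j} be))
  where
  crossing : a ≡ c ⊎ (a ≡ i × c ≡ j) ⊎ (a ≡ j × c ≡ i) →
             b ≡ e ⊎ (b ≡ i × e ≡ j) ⊎ (b ≡ j × e ≡ i) → ⊥
  crossing (inj₁ a≡c) _ = <⇒≢ (<-trans a<b b<c) a≡c
  crossing _ (inj₁ b≡e) = <⇒≢ (<-trans b<c c<e) b≡e
  crossing (inj₂ (inj₁ (a≡i , _))) (inj₂ (inj₁ (b≡i , _))) = <⇒≢ a<b (trans a≡i (sym b≡i))
  crossing (inj₂ (inj₁ (_ , c≡j))) (inj₂ (inj₂ (b≡j , _))) = <⇒≢ b<c (trans b≡j (sym c≡j))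
  crossing (inj₂ (inj₂ (_ , c≡i))) (inj₂ (inj₁ (b≡i , _))) = <⇒≢ b<c (trans b≡i (sym c≡i))
  crossing (inj₂ (inj₂ (a≡j , _))) (inj₂ (inj₂ (b≡j , _))) = <⇒≢ a<b (trans a≡j (sym b≡j))

ChordAvoids : ℕ → Partition → ℕ → ℕ → Set
ChordAvoids d π x y = ∀ a c → InRange d a → InRange d c → π a ≡ π c →
  ¬ Interleave (pos a) (pos c) x y

merge-compatible : ∀ {d π i j} → pos′ d i < pos′ d j →
  ChordAvoids d π (pos′ d i) (pos′ d j) → Compatible d π (merge i j)
merge-compatible {d} {π} {i} {j} i<j avoids a c b e ra rc _ _ πac be crosses
  with merge-related {i} {j} {b} {e} be
... | inj₁ refl                 = <-irrefl refl (interleave⇒< crosses)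
... | inj₂ (inj₁ (refl , refl)) = avoids a c ra rc πac crosses
... | inj₂ (inj₂ (refl , refl)) = <-asym i<j (interleave⇒< crosses)

α-joins-avoiding-chord : ∀ {d π σ i j} → IsAlpha d π σ → InRange d i → InRange d j →
  pos′ d i < pos′ d j → ChordAvoids d π (pos′ d i) (pos′ d j) → σ i ≡ σ j
α-joins-avoiding-chord {d} {π} {σ} {i} {j} (_ , _ , coarsest) ri rj i<j avoids =
  coarsest (merge i j) (merge-noncrossing d i j) (merge-compatible i<j avoids)
    i j ri rj (merge-identifies i j)

BlockClosed : ℕ → Partition → ℕ → ℕ → Set
BlockClosed d π l r = ∀ x y → InRange d y → l < x → x ≤ r → π x ≡ π y → l < y × y ≤ r

block-closed⇒chord-avoids : ∀ {d π l r} → BlockClosed d π l r →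
  ChordAvoids d π (2 * l) (2 * r)
block-closed⇒chord-avoids closed a c ra@(1≤a , _) rc@(1≤c , _) πac crosses
  with Equivalence.to (interleave-gaps⇔ 1≤a 1≤c) crosses
... | inj₁ (a≤l , l<c , c≤r) = <⇒≱ (proj₁ (closed c a ra l<c c≤r (sym πac))) a≤l
... | inj₂ (l<a , a≤r , r<c) = <⇒≱ r<c (proj₂ (closed a c rc l<a a≤r πac))

last-satisfying : ∀ {P : ℕ → Set} → (∀ x → Dec (P x)) → ∀ n →
  (∀ x → 1 ≤ x → x ≤ n → ¬ P x) ⊎
  ∃[ m ] 1 ≤ m × m ≤ n × P m × (∀ x → m < x → x ≤ n → ¬ P x)
last-satisfying P? zero = inj₁ λ x 1≤x x≤0 _ → <⇒≱ 1≤x x≤0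
last-satisfying P? (suc n) with P? (suc n)
... | yes p = inj₂ (suc n , s≤s z≤n , ≤-refl , p , λ x n<x x≤n → ⊥-elim (<⇒≱ n<x x≤n))
... | no ¬p with last-satisfying P? n
...   | inj₁ none = inj₁ λ x 1≤x x≤1+n →
  [ none x 1≤x ∘ ≤-pred , (λ { refl → ¬p }) ]′ (m≤n⇒m<n∨m≡n x≤1+n)
...   | inj₂ (m , 1≤m , m≤n , pm , above) = inj₂ (m , 1≤m , m≤n⇒m≤1+n m≤n , pm , λ x m<x x≤1+n →
  [ above x m<x ∘ ≤-pred , (λ { refl → ¬p }) ]′ (m≤n⇒m<n∨m≡n x≤1+n))

between-consecutive⇒block-closed : ∀ {d π c k} → NonCrossing d π → 1 ≤ c → k < d →
  π c ≡ π (suc k) → (∀ x → c < x → x ≤ k → π x ≢ π (suc k)) → BlockClosed d π c k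
between-consecutive⇒block-closed {d} {π} {c} {k} nc 1≤c k<d πc none-between
  x y (1≤y , y≤d) c<x x≤k πxy = within (y ≤? c) (y ≤? k)
  where
  x-in-block : y ≤ c ⊎ k < y → π x ≡ π (suc k)
  x-in-block (inj₁ y≤c) with m≤n⇒m<n∨m≡n y≤c
  ... | inj₁ y<c = trans πxy (trans (nc y c x (suc k) 1≤y y<c c<x (s≤s x≤k) k<d (sym πxy) πc) πc)
  ... | inj₂ y≡c = trans πxy (trans (cong π y≡c) πc)
  x-in-block (inj₂ k<y) with m≤n⇒m<n∨m≡n k<y
  ... | inj₁ 1+k<y = trans (sym (nc c x (suc k) y 1≤c c<x (s≤s x≤k) 1+k<y y≤d πc πxy)) πc
  ... | inj₂ 1+k≡y = trans πxy (cong π (sym 1+k≡y))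
  within : Dec (y ≤ c) → Dec (y ≤ k) → c < y × y ≤ k
  within (no y≰c) (yes y≤k) = ≰⇒> y≰c , y≤k
  within (yes y≤c) _        = ⊥-elim (none-between x c<x x≤k (x-in-block (inj₁ y≤c)))
  within (no _)    (no y≰k) = ⊥-elim (none-between x c<x x≤k (x-in-block (inj₂ (≰⇒> y≰k))))

block-span⇒block-closed : ∀ {d π k m} → NonCrossing d π → k < m → m ≤ d →
  π (suc k) ≡ π m → (∀ x → 1 ≤ x → x ≤ k → π x ≢ π (suc k)) →
  (∀ x → m < x → x ≤ d → π x ≢ π (suc k)) → BlockClosed d π k m
block-span⇒block-closed {d} {π} {k} {m} nc k<m m≤d πm none-before none-after
  x y (1≤y , y≤d) k<x x≤m πxy = within (y ≤? k) (y ≤? m)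
  where
  strictly-inside : π x ≢ π (suc k) → suc k < x × x < m
  strictly-inside ¬px = ≤∧≢⇒< k<x (λ 1+k≡x → ¬px (cong π (sym 1+k≡x))) ,
                        ≤∧≢⇒< x≤m (λ x≡m → ¬px (trans (cong π x≡m) (sym πm)))
  y-in-block : y ≤ k ⊎ m < y → π y ≡ π (suc k)
  y-in-block outside with π x ≟ π (suc k) | outside
  ... | yes px  | _ = trans (sym πxy) px
  ... | no ¬px | inj₁ y≤k = let (1+k<x , x<m) = strictly-inside ¬px in
    nc y (suc k) x m 1≤y (s≤s y≤k) 1+k<x x<m m≤d (sym πxy) πm
  ... | no ¬px | inj₂ m<y = let (1+k<x , x<m) = strictly-inside ¬px in
    ⊥-elim (¬px (sym (nc (suc k) x m y (s≤s z≤n) 1+k<x x<m m<y y≤d πm πxy)))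
  within : Dec (y ≤ k) → Dec (y ≤ m) → k < y × y ≤ m
  within (no y≰k) (yes y≤m) = ≰⇒> y≰k , y≤m
  within (yes y≤k) _        = ⊥-elim (none-before y 1≤y y≤k (y-in-block (inj₁ y≤k)))
  within (no _)    (no y≰m) = ⊥-elim (none-after y (≰⇒> y≰m) y≤d (y-in-block (inj₂ (≰⇒> y≰m))))

nonadjacent⇒block-closed-gap : ∀ {d π k} → NonCrossing d π → k < d → π k ≢ π (suc k) →
  ∃[ g ] 1 ≤ g × g ≤ d × ((g < k × BlockClosed d π g k) ⊎ (k < g × BlockClosed d π k g))
nonadjacent⇒block-closed-gap {d} {π} {k} nc k<d ¬adj
  with last-satisfying (λ x → π x ≟ π (suc k)) k
... | inj₂ (c , 1≤c , c≤k , πc , none-between) =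
  c , 1≤c , ≤-trans c≤k (<⇒≤ k<d) ,
  inj₁ (≤∧≢⇒< c≤k (λ c≡k → ¬adj (trans (cong π (sym c≡k)) πc)) ,
        between-consecutive⇒block-closed nc 1≤c k<d πc none-between)
... | inj₁ none-before with last-satisfying (λ x → π x ≟ π (suc k)) d
...   | inj₁ none = ⊥-elim (none (suc k) (s≤s z≤n) k<d refl)
...   | inj₂ (m , 1≤m , m≤d , πm , none-after) with m ≤? k
...     | yes m≤k = ⊥-elim (none-before m 1≤m m≤k πm)
...     | no m≰k  = m , 1≤m , m≤d ,
  inj₂ (≰⇒> m≰k , block-span⇒block-closed nc (≰⇒> m≰k) m≤d (sym πm) none-before none-after)

α-joins-block-closed-gaps : ∀ {d π σ l r i j} → IsAlpha d π σ → l < r → BlockClosed d π l r →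
  InRange d i → InRange d j → pos′ d i ≡ 2 * l → pos′ d j ≡ 2 * r → σ i ≡ σ j
α-joins-block-closed-gaps {d} {π} α l<r closed ri rj pi pj = α-joins-avoiding-chord α ri rj
  (subst₂ _<_ (sym pi) (sym pj) (*-monoʳ-< 2 l<r))
  (subst₂ (ChordAvoids d π) (sym pi) (sym pj) (block-closed⇒chord-avoids closed))

adjacent⇒singleton : ∀ {d π σ k} → IsAlpha d π σ → 1 ≤ k → k < d → π k ≡ π (suc k) →
  Singleton d σ (d ∸ k)
adjacent⇒singleton {d} {π} {σ} {k} (_ , compatible , _) 1≤k k<d adj = rk , only-gap-k
  where
  rk : InRange d (d ∸ k)
  rk = m<n⇒0<n∸m k<d , m∸n≤m d k
  pk : pos′ d (d ∸ k) ≡ 2 * k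
  pk = pos′-d∸ 1≤k (<⇒≤ k<d)
  crossing : ∀ i j {g h} → pos′ d i ≡ 2 * g → pos′ d j ≡ 2 * h →
    (k ≤ g × g < suc k × suc k ≤ h) ⊎ (g < k × k ≤ h × h < suc k) →
    Interleave (pos k) (pos (suc k)) (pos′ d i) (pos′ d j)
  crossing i j pi pj = subst₂ (Interleave (pos k) (pos (suc k))) (sym pi) (sym pj)
    ∘ Equivalence.from (interleave-gaps⇔ 1≤k (s≤s z≤n))
  only-gap-k : ∀ j → InRange d j → σ j ≡ σ (d ∸ k) → j ≡ d ∸ k
  only-gap-k j rj σj with pos′-even rj
  ... | g , _ , _ , pj with <-cmp g k
  ...   | tri< g<k _ _ = ⊥-elim (compatible k (suc k) j (d ∸ k) (1≤k , <⇒≤ k<d) (s≤s z≤n , k<d)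
    rj rk adj σj (crossing j (d ∸ k) pj pk (inj₂ (g<k , ≤-refl , n<1+n k))))
  ...   | tri≈ _ g≡k _ = pos′-d∸-unique rj k<d (trans pj (cong (2 *_) g≡k))
  ...   | tri> _ _ k<g = ⊥-elim (compatible k (suc k) (d ∸ k) j (1≤k , <⇒≤ k<d) (s≤s z≤n , k<d)
    rk rj adj (sym σj) (crossing (d ∸ k) j pk pj (inj₁ (≤-refl , n<1+n k , k<g))))

nonadjacent⇒¬singleton : ∀ {d π σ k} → NonCrossing d π → IsAlpha d π σ → 1 ≤ k → k < d →
  π k ≢ π (suc k) → ¬ Singleton d σ (d ∸ k)
nonadjacent⇒¬singleton {d} {π} {σ} {k} nc α 1≤k k<d ¬adj (rk , singleton)
  with nonadjacent⇒block-closed-gap nc k<d ¬adj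
... | g , 1≤g , g≤d , closed with gap-point 1≤g g≤d
...   | j , rj , pj = joined⇒⊥ closed
  where
  pk : pos′ d (d ∸ k) ≡ 2 * k
  pk = pos′-d∸ 1≤k (<⇒≤ k<d)
  joined⇒same-gap : σ j ≡ σ (d ∸ k) → g ≡ k
  joined⇒same-gap σj =
    *-cancelˡ-≡ g k 2 (trans (sym pj) (trans (cong (pos′ d) (singleton j rj σj)) pk))
  joined⇒⊥ : (g < k × BlockClosed d π g k) ⊎ (k < g × BlockClosed d π k g) → ⊥
  joined⇒⊥ (inj₁ (g<k , closed)) =
    <⇒≢ g<k (joined⇒same-gap (α-joins-block-closed-gaps α g<k closed rj rk pj pk))
  joined⇒⊥ (inj₂ (k<g , closed)) =
    <⇒≢ k<g (sym (joined⇒same-gap (sym (α-joins-block-closed-gaps α k<g closed rk rj pk pj))))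

antisingleton⇔adjacent : ∀ {d π k} → 1 ≤ k → k < d → Antisingleton d π k ⇔ π k ≡ π (suc k)
antisingleton⇔adjacent {d} {π} {k} 1≤k k<d with d ∸ k in eq
... | zero  = ⊥-elim (<⇒≱ k<d (m∸n≡0⇒m≤n eq))
... | suc _ = mk⇔ proj₂ ((1≤k , <⇒≤ k<d) ,_)

lemma4p2 : (d : ℕ) → 1 ≤ d → (π : Partition) → IsNC d π →
    (σ : Partition) → IsAlpha d π σ →
    (k : ℕ) → 1 ≤ k → k < d →
    Antisingleton d π k ⇔ Singleton d σ (d ∸ k)
lemma4p2 d _ π nc σ α k 1≤k k<d = mk⇔
  (adjacent⇒singleton α 1≤k k<d ∘ Equivalence.to anti⇔adj)
  (λ single → Equivalence.from anti⇔adj (decidable-stable (π k ≟ π (suc k))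
    (λ ¬adj → nonadjacent⇒¬singleton nc α 1≤k k<d ¬adj single)))
  where
  anti⇔adj : Antisingleton d π k ⇔ π k ≡ π (suc k)
  anti⇔adj = antisingleton⇔adjacent 1≤k k<d
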